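{- Let $a_1,\dots,a_n$ be non-negative integers with $a_1+\cdots+a_n=A$, let $t_1,\dots,t_n$ be non-negative integers with $t_1+\cdots+t_n=T$, let $B$ be an integer, and let $(p_1,\dots,p_n)\in(\mathbb{Z}/2)^n$ be an arbitrary vector of parities. Then $$\sum_{\substack{f_1+\cdots+f_n=B\\ \tilde f_i=p_i,\ i=1,\dots,n}}\ \prod_{i=1}^n\binom{2a_i}{f_i}(f_i)_{t_i}=\sum_{\substack{f_1+\cdots+f_n=2A-B+T\\ \tilde f_i=p_i+\tilde t_i,\ i=1,\dots,n}}\ \prod_{i=1}^n\binom{2a_i}{f_i}(f_i)_{t_i}.$$
   Context: The sums run over integer tuples $(f_1,\dots,f_n)$ (binomial coefficients $\binom{2a}{f}$ vanish unless $0\le f\le 2a$). For an integer $f$, $\tilde f\in\mathbb{Z}/2$ denotes its parity, and $(f)_t=f(f-1)\cdots(f+1-t)$ denotes the falling Pochhammer symbol (with $(f)_0=1$). -}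

module Defs where

open import Data.Nat using (ℕ; zero; suc; _+_; _*_)
open import Data.Nat.Combinatorics using (_C_)
open import Data.Integer using (ℤ; +_) renaming (_-_ to _-ℤ_)
import Data.Integer.Properties as ℤP
open import Data.Parity.Base using (Parity)
import Data.Parity.Properties as PP
open import Data.Fin using (Fin) renaming (zero to fzero; suc to fsuc)
open import Data.List using (List; map; upTo)
open import Data.Nat.ListAction using (sum)
open import Relation.Nullary.Decidable using (Dec; yes; no)
open import Data.Nat.Base using (parity)

falling : ℕ → ℕ → ℕ
falling f zero = 1
falling zero (suc t) = 0
falling (suc f) (suc t) = suc f * falling f t

sumTo : ℕ → (ℕ → ℕ) → ℕ
sumTo m g = sum (map g (upTo (suc m)))

[_] : ∀ {p} {P : Set p} → Dec P → ℕ
[ yes _ ] = 1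
[ no _ ] = 0

-- constrSum n a t q B
--   = Σ over integer tuples (f_1,…,f_n) with f_1+⋯+f_n = B and parity f_i = q_i
--     of Π_i C(2a_i, f_i) (f_i)_{t_i}.
-- Since C(2a_i, f_i) = 0 unless 0 ≤ f_i ≤ 2a_i, it suffices to let each
-- f_i range over {0,…,2a_i}; this is a finite sum computed by recursion on n.
constrSum : (n : ℕ) → (Fin n → ℕ) → (Fin n → ℕ) → (Fin n → Parity) → ℤ → ℕ
constrSum zero a t q B = [ B ℤP.≟ + 0 ]
constrSum (suc n) a t q B =
  sumTo (2 * a fzero) (λ f →
      [ parity f PP.≟ q fzero ]
    * ((2 * a fzero) C f)
    * falling f (t fzero)
    * constrSum n (λ i → a (fsuc i)) (λ i → t (fsuc i)) (λ i → q (fsuc i)) (B -ℤ + f))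

ΣFin : (n : ℕ) → (Fin n → ℕ) → ℕ
ΣFin zero g = 0
ΣFin (suc n) g = g fzero + ΣFin n (λ i → g (fsuc i))

-- Peel off the first coordinate f₁ = f and induct on n. With m = 2a₁, the weight C(m, f) (f)_t
-- equals m! / ((f − t)! (m − f)!) for t ≤ f ≤ m and vanishes otherwise, so it is invariant under
-- the reflection f ↦ m + t − f. As m is even, the reflection shifts the parity of f by that of t.
-- It also sends the constraint B − (m + t − f) on f₂ + ⋯ + fₙ, via the induction hypothesis, to
-- 2(A − a₁) − (B − m − t + f) + (T − t₁) = 2A − B + T − f, the constraint of the right-hand side.
module Submission where

open import Defs
open import Data.Nat using (ℕ)
open import Data.Integer using (ℤ; +_; _+_; _-_; _*_)
open import Data.Parity.Base using (Parity) renaming (_+_ to _+ₚ_)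
open import Data.Nat.Base using (parity)
open import Data.Fin using (Fin)
open import Relation.Binary.PropositionalEquality using (_≡_)

open import Data.Nat using (zero; suc; _≤_; _<_; _∸_; _!; z<s; s<s; s≤s; s≤s⁻¹; _<?_)
  renaming (_+_ to _+ℕ_; _*_ to _*ℕ_)
open import Data.Nat.Properties
open import Data.Nat.Combinatorics using (_C_; nCk≡n!/k![n-k]!; k![n∸k]!∣n!; k>n⇒nCk≡0)
open import Data.Nat.DivMod using (m/n*n≡m)
open import Data.Nat.ListAction using (sum)
open import Data.Nat.ListAction.Properties using (sum-++; sum-↭)
import Data.Integer as ℤ
import Data.Integer.Properties as ℤ
open import Data.Integer.Tactic.RingSolver using (solve-∀)
open import Data.Parity.Base using (0ℙ; 1ℙ)
import Data.Parity.Properties as ℙ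
open import Data.Fin using () renaming (zero to fzero; suc to fsuc)
open import Data.List using ([]; _∷_; applyUpTo; applyDownFrom; reverse; _∷ʳ_)
open import Data.List.Properties using (map-applyUpTo; applyUpTo-∷ʳ; reverse-applyUpTo)
open import Data.List.Relation.Binary.Permutation.Propositional.Properties using (↭-reverse)
open import Function using (id)
open import Relation.Binary.PropositionalEquality using (refl; sym; trans; cong; cong₂; subst; module ≡-Reasoning)
open import Relation.Nullary.Decidable using (yes; no)

open ≡-Reasoning

applyUpTo-cong : ∀ {A : Set} {g h : ℕ → A} n → (∀ i → i < n → g i ≡ h i) →
                 applyUpTo g n ≡ applyUpTo h n
applyUpTo-cong zero    g≗h = refl
applyUpTo-cong (suc n) g≗h = cong₂ _∷_ (g≗h 0 z<s) (applyUpTo-cong n (λ i i<n → g≗h (suc i) (s<s i<n)))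

applyDownFrom≡applyUpTo : ∀ {A : Set} (g : ℕ → A) n →
                          applyDownFrom g n ≡ applyUpTo (λ i → g (n ∸ suc i)) n
applyDownFrom≡applyUpTo g zero    = refl
applyDownFrom≡applyUpTo g (suc n) = cong (g n ∷_) (applyDownFrom≡applyUpTo g n)

sumTo≡sum-applyUpTo : ∀ m g → sumTo m g ≡ sum (applyUpTo g (suc m))
sumTo≡sum-applyUpTo m g = cong sum (map-applyUpTo id g (suc m))

sumTo-cong : ∀ m {g h : ℕ → ℕ} → (∀ f → f ≤ m → g f ≡ h f) → sumTo m g ≡ sumTo m h
sumTo-cong m {g} {h} g≗h = begin
  sumTo m g                  ≡⟨ sumTo≡sum-applyUpTo m g ⟩
  sum (applyUpTo g (suc m))  ≡⟨ cong sum (applyUpTo-cong (suc m) (λ f f<1+m → g≗h f (s≤s⁻¹ f<1+m))) ⟩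
  sum (applyUpTo h (suc m))  ≡⟨ sumTo≡sum-applyUpTo m h ⟨
  sumTo m h                  ∎

sumTo-suc : ∀ m g → sumTo (suc m) g ≡ sumTo m g +ℕ g (suc m)
sumTo-suc m g = begin
  sumTo (suc m) g                                ≡⟨ sumTo≡sum-applyUpTo (suc m) g ⟩
  sum (applyUpTo g (suc (suc m)))                ≡⟨ cong sum (applyUpTo-∷ʳ g (suc m)) ⟨
  sum (applyUpTo g (suc m) ∷ʳ g (suc m))         ≡⟨ sum-++ (applyUpTo g (suc m)) (g (suc m) ∷ []) ⟩
  sum (applyUpTo g (suc m)) +ℕ (g (suc m) +ℕ 0)  ≡⟨ cong₂ _+ℕ_ (sym (sumTo≡sum-applyUpTo m g)) (+-identityʳ (g (suc m))) ⟩
  sumTo m g +ℕ g (suc m)                         ∎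

sumTo-pad : ∀ k m g → (∀ f → m < f → g f ≡ 0) → sumTo (k +ℕ m) g ≡ sumTo m g
sumTo-pad zero    m g g-vanishes = refl
sumTo-pad (suc k) m g g-vanishes = begin
  sumTo (suc (k +ℕ m)) g               ≡⟨ sumTo-suc (k +ℕ m) g ⟩
  sumTo (k +ℕ m) g +ℕ g (suc (k +ℕ m))  ≡⟨ cong (sumTo (k +ℕ m) g +ℕ_) (g-vanishes _ (s≤s (m≤n+m m k))) ⟩
  sumTo (k +ℕ m) g +ℕ 0                ≡⟨ +-identityʳ _ ⟩
  sumTo (k +ℕ m) g                     ≡⟨ sumTo-pad k m g g-vanishes ⟩
  sumTo m g                            ∎

sumTo-reverse : ∀ m g → sumTo m g ≡ sumTo m (λ f → g (m ∸ f))
sumTo-reverse m g = begin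
  sumTo m g                                        ≡⟨ sumTo≡sum-applyUpTo m g ⟩
  sum (applyUpTo g (suc m))                        ≡⟨ sum-↭ (↭-reverse (applyUpTo g (suc m))) ⟨
  sum (reverse (applyUpTo g (suc m)))              ≡⟨ cong sum (reverse-applyUpTo g (suc m)) ⟩
  sum (applyDownFrom g (suc m))                    ≡⟨ cong sum (applyDownFrom≡applyUpTo g (suc m)) ⟩
  sum (applyUpTo (λ f → g (m ∸ f)) (suc m))        ≡⟨ sumTo≡sum-applyUpTo m (λ f → g (m ∸ f)) ⟨
  sumTo m (λ f → g (m ∸ f))                        ∎

sumTo-reflect : ∀ k m g h → (∀ f → m < f → g f ≡ 0) → (∀ f → m < f → h f ≡ 0) →
                (∀ f → f ≤ k +ℕ m → g (k +ℕ m ∸ f) ≡ h f) → sumTo m g ≡ sumTo m h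
sumTo-reflect k m g h g-vanishes h-vanishes g∘reflect≗h = begin
  sumTo m g                                ≡⟨ sumTo-pad k m g g-vanishes ⟨
  sumTo (k +ℕ m) g                         ≡⟨ sumTo-reverse (k +ℕ m) g ⟩
  sumTo (k +ℕ m) (λ f → g (k +ℕ m ∸ f))    ≡⟨ sumTo-cong (k +ℕ m) g∘reflect≗h ⟩
  sumTo (k +ℕ m) h                         ≡⟨ sumTo-pad k m h h-vanishes ⟩
  sumTo m h                                ∎

falling-< : ∀ {f t} → f < t → falling f t ≡ 0
falling-< {zero}  {suc t} _         = refl
falling-< {suc f} {suc t} (s<s f<t) = trans (cong (suc f *ℕ_) (falling-< f<t)) (*-zeroʳ (suc f))

falling*! : ∀ {f t} → t ≤ f → falling f t *ℕ (f ∸ t) ! ≡ f !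
falling*! {f}     {zero}  _         = +-identityʳ (f !)
falling*! {suc f} {suc t} (s≤s t≤f) = trans (*-assoc (suc f) (falling f t) ((f ∸ t) !))
                                             (cong (suc f *ℕ_) (falling*! t≤f))

C*k!*[n∸k]! : ∀ {n k} → k ≤ n → (n C k) *ℕ (k ! *ℕ (n ∸ k) !) ≡ n !
C*k!*[n∸k]! {n} {k} k≤n = trans (cong (_*ℕ (k ! *ℕ (n ∸ k) !)) (nCk≡n!/k![n-k]! k≤n))
                               (m/n*n≡m {{k !* (n ∸ k) !≢0}} (k![n∸k]!∣n! k≤n))

C*falling*[f∸t]!*[m∸f]! : ∀ {m t f} → t ≤ f → f ≤ m →
                          (m C f) *ℕ falling f t *ℕ ((f ∸ t) ! *ℕ (m ∸ f) !) ≡ m !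
C*falling*[f∸t]!*[m∸f]! {m} {t} {f} t≤f f≤m = begin
  (m C f) *ℕ falling f t *ℕ ((f ∸ t) ! *ℕ (m ∸ f) !)    ≡⟨ *-assoc (m C f) (falling f t) _ ⟩
  (m C f) *ℕ (falling f t *ℕ ((f ∸ t) ! *ℕ (m ∸ f) !))  ≡⟨ cong ((m C f) *ℕ_) (*-assoc (falling f t) ((f ∸ t) !) _) ⟨
  (m C f) *ℕ (falling f t *ℕ (f ∸ t) ! *ℕ (m ∸ f) !)    ≡⟨ cong (λ x → (m C f) *ℕ (x *ℕ (m ∸ f) !)) (falling*! t≤f) ⟩
  (m C f) *ℕ (f ! *ℕ (m ∸ f) !)                         ≡⟨ C*k!*[n∸k]! f≤m ⟩
  m !                                                   ∎

+-<-complement : ∀ {x y u v} → x +ℕ y ≡ u +ℕ v → x < u → v < y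
+-<-complement {x} {y} {u} {v} eq x<u = +-cancelˡ-< u v y (subst (_< u +ℕ y) eq (+-monoˡ-< y x<u))

+-∸-complement : ∀ {x y u v} → x +ℕ y ≡ u +ℕ v → u ≤ x → (x ∸ u) +ℕ y ≡ v
+-∸-complement {x} {y} {u} {v} eq u≤x = +-cancelˡ-≡ u _ _ (begin
  u +ℕ (x ∸ u +ℕ y)    ≡⟨ +-assoc u (x ∸ u) y ⟨
  u +ℕ (x ∸ u) +ℕ y    ≡⟨ cong (_+ℕ y) (m+[n∸m]≡n u≤x) ⟩
  x +ℕ y               ≡⟨ eq ⟩
  u +ℕ v               ∎)

C*falling-reflect-inside : ∀ {m t f g} → f +ℕ g ≡ t +ℕ m → t ≤ f → f ≤ m →
                           (m C f) *ℕ falling f t ≡ (m C g) *ℕ falling g t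
C*falling-reflect-inside {m} {t} {f} {g} f+g≡t+m t≤f f≤m =
  *-cancelʳ-≡ _ _ ((f ∸ t) ! *ℕ (m ∸ f) !) {{(f ∸ t) !* (m ∸ f) !≢0}} (begin
    (m C f) *ℕ falling f t *ℕ ((f ∸ t) ! *ℕ (m ∸ f) !)  ≡⟨ C*falling*[f∸t]!*[m∸f]! t≤f f≤m ⟩
    m !                                                 ≡⟨ C*falling*[f∸t]!*[m∸f]! t≤g g≤m ⟨
    (m C g) *ℕ falling g t *ℕ ((g ∸ t) ! *ℕ (m ∸ g) !)  ≡⟨ cong ((m C g) *ℕ falling g t *ℕ_) cofactors ⟩
    (m C g) *ℕ falling g t *ℕ ((f ∸ t) ! *ℕ (m ∸ f) !)  ∎)
  where
  f∸t+g≡m : f ∸ t +ℕ g ≡ m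
  f∸t+g≡m = +-∸-complement f+g≡t+m t≤f
  m∸f+t≡g : m ∸ f +ℕ t ≡ g
  m∸f+t≡g = +-∸-complement (trans (+-comm m t) (sym f+g≡t+m)) f≤m
  t≤g : t ≤ g
  t≤g = subst (t ≤_) m∸f+t≡g (m≤n+m t (m ∸ f))
  g≤m : g ≤ m
  g≤m = subst (g ≤_) f∸t+g≡m (m≤n+m g (f ∸ t))
  cofactors : (g ∸ t) ! *ℕ (m ∸ g) ! ≡ (f ∸ t) ! *ℕ (m ∸ f) !
  cofactors = begin
    (g ∸ t) ! *ℕ (m ∸ g) !                        ≡⟨ cong₂ (λ x y → (x ∸ t) ! *ℕ (y ∸ g) !) m∸f+t≡g f∸t+g≡m ⟨
    (m ∸ f +ℕ t ∸ t) ! *ℕ (f ∸ t +ℕ g ∸ g) !      ≡⟨ cong₂ (λ x y → x ! *ℕ y !) (m+n∸n≡m (m ∸ f) t) (m+n∸n≡m (f ∸ t) g) ⟩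
    (m ∸ f) ! *ℕ (f ∸ t) !                        ≡⟨ *-comm ((m ∸ f) !) ((f ∸ t) !) ⟩
    (f ∸ t) ! *ℕ (m ∸ f) !                        ∎

C*falling-reflect : ∀ {m t f g} → f +ℕ g ≡ t +ℕ m → (m C f) *ℕ falling f t ≡ (m C g) *ℕ falling g t
C*falling-reflect {m} {t} {f} {g} f+g≡t+m with f <? t | m <? f
... | yes f<t | _ = begin
  (m C f) *ℕ falling f t  ≡⟨ cong ((m C f) *ℕ_) (falling-< f<t) ⟩
  (m C f) *ℕ 0            ≡⟨ *-zeroʳ (m C f) ⟩
  0                       ≡⟨ cong (_*ℕ falling g t) (k>n⇒nCk≡0 (+-<-complement f+g≡t+m f<t)) ⟨
  (m C g) *ℕ falling g t  ∎
... | no _ | yes m<f = begin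
  (m C f) *ℕ falling f t  ≡⟨ cong (_*ℕ falling f t) (k>n⇒nCk≡0 m<f) ⟩
  0                       ≡⟨ *-zeroʳ (m C g) ⟨
  (m C g) *ℕ 0            ≡⟨ cong ((m C g) *ℕ_) (falling-< g<t) ⟨
  (m C g) *ℕ falling g t  ∎
  where
  g<t : g < t
  g<t = +-<-complement (trans (+-comm m t) (sym f+g≡t+m)) m<f
... | no f≮t | no m≮f = C*falling-reflect-inside f+g≡t+m (≮⇒≥ f≮t) (≮⇒≥ m≮f)

[≟]-complement : ∀ u v p → [ v ℙ.≟ p ] ≡ [ u ℙ.≟ p +ₚ (u +ₚ v) ]
[≟]-complement 0ℙ 0ℙ 0ℙ = refl
[≟]-complement 0ℙ 0ℙ 1ℙ = refl
[≟]-complement 0ℙ 1ℙ 0ℙ = refl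
[≟]-complement 0ℙ 1ℙ 1ℙ = refl
[≟]-complement 1ℙ 0ℙ 0ℙ = refl
[≟]-complement 1ℙ 0ℙ 1ℙ = refl
[≟]-complement 1ℙ 1ℙ 0ℙ = refl
[≟]-complement 1ℙ 1ℙ 1ℙ = refl

parity-+-∸ : ∀ {f M} → f ≤ M → parity f +ₚ parity (M ∸ f) ≡ parity M
parity-+-∸ {f} {M} f≤M = trans (sym (ℙ.+-homo-+ f (M ∸ f))) (cong parity (m+[n∸m]≡n f≤M))

parity-+-even : ∀ t a → parity (t +ℕ 2 *ℕ a) ≡ parity t
parity-+-even t a = begin
  parity (t +ℕ 2 *ℕ a)         ≡⟨ ℙ.+-homo-+ t (2 *ℕ a) ⟩
  parity t +ₚ parity (2 *ℕ a)  ≡⟨ cong (parity t +ₚ_) (ℙ.*-homo-* 2 a) ⟩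
  parity t +ₚ 0ℙ               ≡⟨ ℙ.+-identityʳ (parity t) ⟩
  parity t                     ∎

[≟0]-neg : ∀ B → [ B ℤ.≟ + 0 ] ≡ [ ℤ.- B ℤ.≟ + 0 ]
[≟0]-neg (+ zero)    = refl
[≟0]-neg (+ suc _)   = refl
[≟0]-neg ℤ.-[1+ _ ] = refl

+[m∸n]≡+m-+n : ∀ {m n} → n ≤ m → + (m ∸ n) ≡ + m - + n
+[m∸n]≡+m-+n {m} {n} n≤m = sym (trans (ℤ.m-n≡m⊖n m n) (ℤ.⊖-≥ n≤m))

reflected-index : ∀ a₀ A t₀ T B {f} → f ≤ t₀ +ℕ 2 *ℕ a₀ →
                  + 2 * + A - (B - + (t₀ +ℕ 2 *ℕ a₀ ∸ f)) + + T
                    ≡ + 2 * + (a₀ +ℕ A) - B + + (t₀ +ℕ T) - + f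
reflected-index a₀ A t₀ T B {f} f≤M = begin
  + 2 * + A - (B - + (t₀ +ℕ 2 *ℕ a₀ ∸ f)) + + T
    ≡⟨ cong (λ x → + 2 * + A - (B - x) + + T) (+[m∸n]≡+m-+n f≤M) ⟩
  + 2 * + A - (B - (+ (t₀ +ℕ 2 *ℕ a₀) - + f)) + + T
    ≡⟨ cong (λ x → + 2 * + A - (B - (x - + f)) + + T) (trans (ℤ.pos-+ t₀ _) (cong (λ x → + t₀ + x) (ℤ.pos-* 2 a₀))) ⟩
  + 2 * + A - (B - (+ t₀ + + 2 * + a₀ - + f)) + + T
    ≡⟨ ring (+ a₀) (+ A) (+ t₀) (+ T) B (+ f) ⟩
  + 2 * (+ a₀ + + A) - B + (+ t₀ + + T) - + f
    ≡⟨ cong₂ (λ x y → + 2 * x - B + y - + f) (ℤ.pos-+ a₀ A) (ℤ.pos-+ t₀ T) ⟨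
  + 2 * + (a₀ +ℕ A) - B + + (t₀ +ℕ T) - + f
    ∎
  where
  ring : ∀ a₀ A t₀ T B f → + 2 * A - (B - (t₀ + + 2 * a₀ - f)) + T ≡ + 2 * (a₀ + A) - B + (t₀ + T) - f
  ring = solve-∀

summand-≡0 : ∀ {m f} i x y → m < f → i *ℕ (m C f) *ℕ x *ℕ y ≡ 0
summand-≡0 {m} {f} i x y m<f = begin
  i *ℕ (m C f) *ℕ x *ℕ y  ≡⟨ cong (λ c → i *ℕ c *ℕ x *ℕ y) (k>n⇒nCk≡0 m<f) ⟩
  i *ℕ 0 *ℕ x *ℕ y        ≡⟨ cong (λ z → z *ℕ x *ℕ y) (*-zeroʳ i) ⟩
  0                       ∎

constrSum-reflect : ∀ n (a t : Fin n → ℕ) (p : Fin n → Parity) (B : ℤ) →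
                    constrSum n a t p B
                      ≡ constrSum n a t (λ i → p i +ₚ parity (t i)) (+ 2 * + ΣFin n a - B + + ΣFin n t)
constrSum-reflect zero    a t p B = trans ([≟0]-neg B) (cong (λ x → [ x ℤ.≟ + 0 ]) (ring B))
  where
  ring : ∀ B → ℤ.- B ≡ + 2 * + 0 - B + + 0
  ring = solve-∀
constrSum-reflect (suc n) a t p B =
  sumTo-reflect t₀ m lhs-summand rhs-summand
    (λ f → summand-≡0 [ parity f ℙ.≟ p₀ ] (falling f t₀) (X (B - + f)))
    (λ f → summand-≡0 [ parity f ℙ.≟ p₀ +ₚ parity t₀ ] (falling f t₀) (Y (R - + f)))
    reflected-summand
  where
  a₀ t₀ m M : ℕ
  a₀ = a fzero
  t₀ = t fzero
  m = 2 *ℕ a₀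
  M = t₀ +ℕ m
  p₀ : Parity
  p₀ = p fzero
  R : ℤ
  R = + 2 * + ΣFin (suc n) a - B + + ΣFin (suc n) t
  a′ t′ : Fin n → ℕ
  a′ i = a (fsuc i)
  t′ i = t (fsuc i)
  X Y : ℤ → ℕ
  X = constrSum n a′ t′ (λ i → p (fsuc i))
  Y = constrSum n a′ t′ (λ i → p (fsuc i) +ₚ parity (t′ i))

  lhs-summand rhs-summand : ℕ → ℕ
  lhs-summand f = [ parity f ℙ.≟ p₀ ] *ℕ (m C f) *ℕ falling f t₀ *ℕ X (B - + f)
  rhs-summand f = [ parity f ℙ.≟ p₀ +ₚ parity t₀ ] *ℕ (m C f) *ℕ falling f t₀ *ℕ Y (R - + f)

  reflected-summand : ∀ f → f ≤ M → lhs-summand (M ∸ f) ≡ rhs-summand f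
  reflected-summand f f≤M = begin
    [ parity g ℙ.≟ p₀ ] *ℕ (m C g) *ℕ falling g t₀ *ℕ X (B - + g)
      ≡⟨ cong (_*ℕ X (B - + g)) (*-assoc [ parity g ℙ.≟ p₀ ] (m C g) _) ⟩
    [ parity g ℙ.≟ p₀ ] *ℕ ((m C g) *ℕ falling g t₀) *ℕ X (B - + g)
      ≡⟨ cong₂ _*ℕ_ (cong₂ _*ℕ_ indicator weight) recursive ⟩
    [ parity f ℙ.≟ p₀ +ₚ parity t₀ ] *ℕ ((m C f) *ℕ falling f t₀) *ℕ Y (R - + f)
      ≡⟨ cong (_*ℕ Y (R - + f)) (*-assoc [ parity f ℙ.≟ p₀ +ₚ parity t₀ ] (m C f) _) ⟨
    [ parity f ℙ.≟ p₀ +ₚ parity t₀ ] *ℕ (m C f) *ℕ falling f t₀ *ℕ Y (R - + f)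
      ∎
    where
    g : ℕ
    g = M ∸ f
    indicator : [ parity g ℙ.≟ p₀ ] ≡ [ parity f ℙ.≟ p₀ +ₚ parity t₀ ]
    indicator = trans ([≟]-complement (parity f) (parity g) p₀)
                      (cong (λ q → [ parity f ℙ.≟ p₀ +ₚ q ]) (trans (parity-+-∸ f≤M) (parity-+-even t₀ a₀)))
    weight : (m C g) *ℕ falling g t₀ ≡ (m C f) *ℕ falling f t₀
    weight = C*falling-reflect {m} {t₀} {g} {f} (m∸n+n≡m f≤M)
    recursive : X (B - + g) ≡ Y (R - + f)
    recursive = trans (constrSum-reflect n a′ t′ (λ i → p (fsuc i)) (B - + g))
                      (cong Y (reflected-index a₀ (ΣFin n a′) t₀ (ΣFin n t′) B f≤M))

lemmaA1 : (n : ℕ) (a t : Fin n → ℕ) (A T : ℕ) → ΣFin n a ≡ A → ΣFin n t ≡ T →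
          (B : ℤ) (p : Fin n → Parity) →
          constrSum n a t p B
            ≡ constrSum n a t (λ i → p i +ₚ parity (t i)) (+ 2 * + A - B + + T)
lemmaA1 n a t _ _ refl refl B p = constrSum-reflect n a t p B
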